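{- (i) The map $v\mapsto ?_V^{ -1}(v)$ is a bijection from $A^*$ onto $\mathbb{Q}_1=\mathbb{Q}\cap(0,1)$; equivalently, the sequence $V_{10}$ contains every element of $\mathbb{Q}_1$ exactly once. (ii) The map $v\mapsto \hat{?}^{ -1}(v)$ is a bijection from $A^*$ onto $\mathbb{Q}^+=\mathbb{Q}\cap(0,\infty)$; equivalently, the sequence $V_1$ contains every element of $\mathbb{Q}^+$ exactly once. (iii) The map $v\mapsto \hat{\hat{?}}^{ -1}(v)$ is a bijection from $A^*$ onto $\mathbb{Q}$; equivalently, the sequence $V$ contains every element of $\mathbb{Q}$ exactly once.
   Context: Let $A=\{0,1\}$, $A^*$ the set of finite binary words (including the empty word $\varepsilon$), $A^\omega$ the infinite binary words, and for $w\in A^*$ let $\overline{w}$ denote its bitwise complement ($0\leftrightarrow 1$). Codes: for $b\in\mathbb{N}=\{1,2,\dots\}$ with binary expansion $b=\sum_{k=0}^{l}b_k2^k$, $l=\lfloor\log_2 b\rfloor$ (so $b_l=1$), set $C_I(b)=0^l\,1\,\overline{b_{l-1}}\,\overline{b_{l-2}}\cdots\overline{b_0}$ and $C_{II}(b)=\overline{C_I(b)}=1^l\,0\,b_{l-1}\cdots b_0$; also $C_I(\aleph_0)=0^\omega$, $C_{II}(\aleph_0)=1^\omega$. These are complete prefix-free codes. Continued fractions: every $p/q\in\mathbb{Q}_1$ has a unique finite continued fraction expansion $p/q=[b_1,b_2,\dots,b_{2l}]=\cfrac{1}{b_1+\cfrac{1}{b_2+\cdots}}$ with an even number of partial denominators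 $b_i\in\mathbb{N}$ (using $[\dots,b_m]=[\dots,b_m-1,1]$ to adjust parity). $?_V^{ -1}\colon A^*\to\mathbb{Q}_1$: for $v\in A^*$, decompose the infinite word $v\,1\,0^\omega$ (uniquely) as $C_I(b_1)\,C_{II}(b_2)\cdots C_I(b_{2l-1})\,C_{II}(b_{2l})\,C_I(\aleph_0)$, alternating the codes starting with $C_I$, and set $?_V^{ -1}(v)=[b_1,\dots,b_{2l}]$. $\hat{?}^{ -1}\colon A^*\to\mathbb{Q}^+$: $\hat{?}^{ -1}(\varepsilon)=1$, $\hat{?}^{ -1}(0v)=?_V^{ -1}(v)$, $\hat{?}^{ -1}(1v)=\big(?_V^{ -1}(\overline v)\big)^{ -1}$. $\hat{\hat{?}}^{ -1}\colon A^*\to\mathbb{Q}$: $\hat{\hat{?}}^{ -1}(\varepsilon)=0$, $\hat{\hat{?}}^{ -1}(0v)=-\hat{?}^{ -1}(\overline v)$, $\hat{\hat{?}}^{ -1}(1v)=\hat{?}^{ -1}(v)$. The sequences $V_{10},V_1,V$ list the values $?_V^{ -1}(v)$, $\hat{?}^{ -1}(v)$, $\hat{\hat{?}}^{ -1}(v)$ respectively, for $v\in A^*$ ordered by the integer $n=(1v)_2$ (the binary number with digits $1v$), $n=1,2,3,\dots$. -}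

module Defs where

open import Data.Bool using (Bool; true; false; not)
open import Data.Nat using (ℕ; zero; suc; _+_; _*_)
open import Data.Integer using (ℤ; +_; -[1+_])
open import Data.List using (List; []; _∷_; _++_; length; map)
open import Data.Product using (_×_; _,_)
open import Data.Rational using (ℚ; _/_; 0ℚ; 1ℚ; -_) renaming (_+_ to _+ℚ_)

-- Finite binary words A* ; false = 0, true = 1.
Word : Set
Word = List Bool

complement : Word → Word
complement = map not

bit : Bool → ℕ
bit false = 0
bit true  = 1

-- Total reciprocal on ℚ (1/0 := 0; only ever applied to nonzero values below).
recipℚ : ℚ → ℚ
recipℚ q with ℚ.numerator q
... | + zero    = 0ℚ
... | + suc n   = + suc (ℚ.denominator-1 q) / suc n
... | -[1+ n ]  = -[1+ ℚ.denominator-1 q ] / suc n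

cf : List ℕ → ℚ
cf []       = 0ℚ
cf (b ∷ bs) = recipℚ ((+ b / 1) +ℚ cf bs)

-- The infinite word  w 0^ω  is represented by the finite list w
-- (reading past its end yields 0 = false).

span= : Bool → Word → ℕ × Word
span= c [] = (0 , [])
span= true  (true ∷ xs)  with span= true xs
... | (l , r) = (suc l , r)
span= false (false ∷ xs) with span= false xs
... | (l , r) = (suc l , r)
span= true  (false ∷ xs) = (0 , false ∷ xs)
span= false (true ∷ xs)  = (0 , true ∷ xs)

readBits : Bool → ℕ → Word → ℕ → ℕ × Word
readBits c zero    xs       acc = (acc , xs)
readBits c (suc l) []       acc = readBits c l [] (2 * acc + bit c)
readBits c (suc l) (x ∷ xs) acc =
  readBits c l xs (2 * acc + bit (if c then not x else x))
  where
  open import Data.Bool using (if_then_else_)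

data CodeI : Set where
  aleph0 : CodeI                 -- the rest of the stream is 0^ω
  fin    : ℕ → Word → CodeI

-- Decode one C_I codeword:  0^l 1 ~b_{l-1} ... ~b_0.
decodeI : Word → CodeI
decodeI w with span= false w
... | (l , [])       = aleph0
... | (l , _ ∷ r) with readBits true l r 1
...   | (b , r') = fin b r'

-- Decode one C_II codeword:  1^l 0 b_{l-1} ... b_0.
decodeII : Word → ℕ × Word
decodeII w with span= true w
... | (l , [])    = readBits false l [] 1
... | (l , _ ∷ r) = readBits false l r 1

-- Decompose the stream as C_I(b1) C_II(b2) ... C_I(b_{2l-1}) C_II(b_{2l}) C_I(ℵ0);
-- the fuel argument bounds the number of (C_I, C_II) pairs.
decompose : ℕ → Word → List ℕ
decompose zero    w = []
decompose (suc f) w with decodeI w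
... | aleph0 = []
... | fin b₁ r with decodeII r
...   | (b₂ , r') = b₁ ∷ b₂ ∷ decompose f r'

-- ?_V^{-1}(v) = [b1,...,b_{2l}] where v 1 0^ω decomposes as above.
-- (length (v ++ [1]) + 1 pairs always suffice: every C_I(b), b finite,
--  consumes at least one letter of v 1.)
?V⁻¹ : Word → ℚ
?V⁻¹ v = cf (decompose (suc (length w)) w)
  where w = v ++ (true ∷ [])

?̂⁻¹ : Word → ℚ
?̂⁻¹ []          = 1ℚ
?̂⁻¹ (false ∷ v) = ?V⁻¹ v
?̂⁻¹ (true ∷ v)  = recipℚ (?V⁻¹ (complement v))

?̂̂⁻¹ : Word → ℚ
?̂̂⁻¹ []          = 0ℚ
?̂̂⁻¹ (false ∷ v) = - ?̂⁻¹ (complement v)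
?̂̂⁻¹ (true ∷ v)  = ?̂⁻¹ v

module Submission where

-- By definition ?V⁻¹ v = cf (digitsOf v), where digitsOf v is the digit
-- sequence obtained by decomposing v 1 0^ω into codewords
-- C_I(b₁) C_II(b₂) … C_II(b_{2l}) C_I(ℵ₀).
--
-- Since b ↦ C(b) is a bijection
--   between positive integers and bit strings, digitsOf is a bijection from
--   A* onto the admissible sequences: nonempty, of even length, positive.
-- * module ContinuedFractions: for positive digits cf takes values in
--   (0,1], is injective on sequences of a fixed length parity (the only
--   coincidence is [.., b, 1] = [.., b+1]), and Euclid's algorithm expands
--   every fraction in (0,1) with either parity; 1 = [1] has odd length only.
--
-- Parts (ii) and (iii) follow by splitting ℚ⁺ into (0,1), {1}, (1,∞) via the
-- reciprocal, and ℚ into negatives, {0}, positives via negation.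

module Decomposition where

  open import Defs
  open import Data.Bool using (Bool; true; false; not)
  open import Data.Bool.Properties using (not-involutive)
  open import Data.Nat using (ℕ; zero; suc; _+_; _*_; _≤_; _<_; z≤n; s≤s; ⌊_/2⌋)
  open import Data.Nat.Properties
    using (≤-refl; ≤-trans; ≤-reflexive; <-≤-trans; ≤-<-trans; m≤n⇒m≤1+n; m≤m+n; +-suc; +-identityʳ; ⌊n/2⌋<n)
  open import Data.Nat.Induction using (<-rec)
  open import Data.List using (List; []; _∷_; _++_; length; map; replicate; reverse)
  open import Data.List.Properties using (∷-injective; ++-assoc; map-id; unfold-reverse; reverse-involutive; reverse-injective)
  open import Data.List.Relation.Unary.All using (All; []; _∷_)
  open import Data.Product using (_×_; _,_; proj₁; proj₂; ∃; ∃₂; uncurry)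
  open import Data.Sum using (_⊎_; inj₁; inj₂)
  open import Data.Empty using (⊥; ⊥-elim)
  open import Data.Unit using (⊤; tt)
  open import Function using (_∘_)
  open import Relation.Binary.PropositionalEquality

  -- Words up to trailing zeros.  The decoders read a finite word w as the
  -- infinite word w 0^ω, so the relevant equality on words is
  -- u ≈ w  ⇔  u 0^ω = w 0^ω.

  data Zeros : Word → Set where
    []  : Zeros []
    0∷_ : ∀ {w} → Zeros w → Zeros (false ∷ w)

  infix 4 _≈_
  data _≈_ : Word → Word → Set where
    zeros : ∀ {u w} → Zeros u → Zeros w → u ≈ w
    _∷_   : ∀ {u w} x → u ≈ w → x ∷ u ≈ x ∷ w

  Zeros-resp : ∀ {u w} → Zeros u → u ≈ w → Zeros w
  Zeros-resp zu       (zeros _ zw) = zw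
  Zeros-resp (0∷ zu) (.false ∷ e) = 0∷ Zeros-resp zu e

  ≈-refl : ∀ w → w ≈ w
  ≈-refl []      = zeros [] []
  ≈-refl (x ∷ w) = x ∷ ≈-refl w

  ≈-sym : ∀ {u w} → u ≈ w → w ≈ u
  ≈-sym (zeros zu zw) = zeros zw zu
  ≈-sym (x ∷ e)       = x ∷ ≈-sym e

  ≈-trans : ∀ {u v w} → u ≈ v → v ≈ w → u ≈ w
  ≈-trans (zeros zu zv) e        = zeros zu (Zeros-resp zv e)
  ≈-trans (x ∷ e) (zeros zv zw)  = zeros (Zeros-resp zv (≈-sym (x ∷ e))) zw
  ≈-trans (x ∷ e) (.x ∷ f)       = x ∷ ≈-trans e f

  ≈-prefix : ∀ p {u w} → u ≈ w → p ++ u ≈ p ++ w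
  ≈-prefix []      e = e
  ≈-prefix (x ∷ p) e = x ∷ ≈-prefix p e

  Zeros-replicate : ∀ n → Zeros (replicate n false)
  Zeros-replicate zero    = []
  Zeros-replicate (suc n) = 0∷ Zeros-replicate n

  ¬Zeros-1 : ∀ v s → Zeros (v ++ true ∷ s) → ⊥
  ¬Zeros-1 []      s ()
  ¬Zeros-1 (x ∷ v) s (0∷ z) = ¬Zeros-1 v s z

  -- The word v 1 is determined by (v 1) 0^ω: this makes v ↦ v 1 0^ω injective.
  ≈-cancel-1 : ∀ v v' → v ++ true ∷ [] ≈ v' ++ true ∷ [] → v ≡ v'
  ≈-cancel-1 []      []        _            = refl
  ≈-cancel-1 []      (x ∷ v')  (zeros z _)  = ⊥-elim (¬Zeros-1 [] [] z)
  ≈-cancel-1 []      (x ∷ v')  (.true ∷ e)  = ⊥-elim (¬Zeros-1 v' [] (Zeros-resp [] e))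
  ≈-cancel-1 (x ∷ v) []        (zeros z _)  = ⊥-elim (¬Zeros-1 (x ∷ v) [] z)
  ≈-cancel-1 (x ∷ v) []        (.true ∷ e)  = ⊥-elim (¬Zeros-1 v [] (Zeros-resp [] (≈-sym e)))
  ≈-cancel-1 (x ∷ v) (y ∷ v')  (zeros z _)  = ⊥-elim (¬Zeros-1 (x ∷ v) [] z)
  ≈-cancel-1 (x ∷ v) (.x ∷ v') (.x ∷ e)     = cong (x ∷_) (≈-cancel-1 v v' e)

  lastOne : ∀ w → Zeros w ⊎ ∃₂ λ v k → w ≡ v ++ true ∷ replicate k false
  lastOne [] = inj₁ []
  lastOne (x ∷ w) with lastOne w
  ... | inj₂ (v , k , e) = inj₂ (x ∷ v , k , cong (x ∷_) e)
  lastOne (false ∷ w) | inj₁ z = inj₁ (0∷ z)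
  lastOne (true ∷ w)  | inj₁ z = inj₂ ([] , length w , cong (true ∷_) (zerosForm z))
    where
    zerosForm : ∀ {w} → Zeros w → w ≡ replicate (length w) false
    zerosForm []     = refl
    zerosForm (0∷ z) = cong (false ∷_) (zerosForm z)

  -- The number of 1s of a word; it is an invariant of ≈ and bounds the number
  -- of C_I codewords (each contains a 1) that the decomposition can consume.
  ones : Word → ℕ
  ones []          = 0
  ones (true ∷ w)  = suc (ones w)
  ones (false ∷ w) = ones w

  ones-≈ : ∀ {u w} → u ≈ w → ones u ≡ ones w
  ones-≈ (zeros zu zw) = trans (noOnes zu) (sym (noOnes zw))
    where
    noOnes : ∀ {w} → Zeros w → ones w ≡ 0
    noOnes []     = refl
    noOnes (0∷ z) = noOnes z
  ones-≈ (true ∷ e)  = cong suc (ones-≈ e)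
  ones-≈ (false ∷ e) = ones-≈ e

  ones-suffix : ∀ p w → ones w ≤ ones (p ++ w)
  ones-suffix []          w = ≤-refl
  ones-suffix (true ∷ p)  w = m≤n⇒m≤1+n (ones-suffix p w)
  ones-suffix (false ∷ p) w = ones-suffix p w

  ones≤length : ∀ w → ones w ≤ length w
  ones≤length []          = z≤n
  ones≤length (true ∷ w)  = s≤s (ones≤length w)
  ones≤length (false ∷ w) = m≤n⇒m≤1+n (ones≤length w)

  -- Binary numerals.  `numAcc acc a` appends the bits a to the binary
  -- expansion of acc (this is how readBits accumulates), and `num a` is the
  -- number with binary expansion 1a, i.e. the b with C_I(b) = 0^|a| 1 ~a.
  numAcc : ℕ → List Bool → ℕ
  numAcc acc []       = acc
  numAcc acc (x ∷ xs) = numAcc (2 * acc + bit x) xs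

  num : List Bool → ℕ
  num = numAcc 1

  numAcc-≥ : ∀ acc a → acc ≤ numAcc acc a
  numAcc-≥ acc []      = ≤-refl
  numAcc-≥ acc (x ∷ a) =
    ≤-trans (≤-trans (m≤m+n acc (acc + 0)) (m≤m+n (2 * acc) (bit x))) (numAcc-≥ (2 * acc + bit x) a)

  numAcc-snoc : ∀ acc a x → numAcc acc (a ++ x ∷ []) ≡ 2 * numAcc acc a + bit x
  numAcc-snoc acc []      x = refl
  numAcc-snoc acc (y ∷ a) x = numAcc-snoc (2 * acc + bit y) a x

  parity : ℕ → Bool
  parity zero    = false
  parity (suc n) = not (parity n)

  2*suc : ∀ m b → 2 * suc m + b ≡ suc (suc (2 * m + b))
  2*suc m b = cong (λ k → suc k + b) (+-suc m (m + 0))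

  half-2*+bit : ∀ m x → ⌊ 2 * m + bit x /2⌋ ≡ m
  half-2*+bit zero    false = refl
  half-2*+bit zero    true  = refl
  half-2*+bit (suc m) x = trans (cong ⌊_/2⌋ (2*suc m (bit x))) (cong suc (half-2*+bit m x))

  parity-2*+bit : ∀ m x → parity (2 * m + bit x) ≡ x
  parity-2*+bit zero    false = refl
  parity-2*+bit zero    true  = refl
  parity-2*+bit (suc m) x =
    trans (cong parity (2*suc m (bit x))) (trans (not-involutive _) (parity-2*+bit m x))

  2*half+parity : ∀ n → 2 * ⌊ n /2⌋ + bit (parity n) ≡ n
  2*half+parity zero          = refl
  2*half+parity (suc zero)    = refl
  2*half+parity (suc (suc n)) rewrite not-involutive (parity n) | 2*suc ⌊ n /2⌋ (bit (parity n)) =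
    cong (suc ∘ suc) (2*half+parity n)

  -- Reading the bits least significant first turns numerals into a structural
  -- recursion, in which injectivity and surjectivity are simple inductions.
  numʳ : List Bool → ℕ
  numʳ r = num (reverse r)

  numʳ-∷ : ∀ x r → numʳ (x ∷ r) ≡ 2 * numʳ r + bit x
  numʳ-∷ x r = trans (cong num (unfold-reverse x r)) (numAcc-snoc 1 (reverse r) x)

  numʳ-∷≢1 : ∀ x r → numʳ (x ∷ r) ≡ 1 → ⊥
  numʳ-∷≢1 x r e = 1≰0 (subst (1 ≤_) numʳr≡0 (numAcc-≥ 1 (reverse r)))
    where
    open ≡-Reasoning
    1≰0 : 1 ≤ 0 → ⊥
    1≰0 ()
    numʳr≡0 : numʳ r ≡ 0
    numʳr≡0 = begin
      numʳ r                     ≡⟨ half-2*+bit (numʳ r) x ⟨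
      ⌊ 2 * numʳ r + bit x /2⌋   ≡⟨ cong ⌊_/2⌋ (numʳ-∷ x r) ⟨
      ⌊ numʳ (x ∷ r) /2⌋         ≡⟨ cong ⌊_/2⌋ e ⟩
      0                          ∎

  numʳ-injective : ∀ r r' → numʳ r ≡ numʳ r' → r ≡ r'
  numʳ-injective []      []       e = refl
  numʳ-injective []      (y ∷ r') e = ⊥-elim (numʳ-∷≢1 y r' (sym e))
  numʳ-injective (x ∷ r) []       e = ⊥-elim (numʳ-∷≢1 x r e)
  numʳ-injective (x ∷ r) (y ∷ r') e = cong₂ _∷_ x≡y (numʳ-injective r r' m≡m')
    where
    e' : 2 * numʳ r + bit x ≡ 2 * numʳ r' + bit y
    e' = trans (sym (numʳ-∷ x r)) (trans e (numʳ-∷ y r'))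
    x≡y : x ≡ y
    x≡y = trans (sym (parity-2*+bit (numʳ r) x)) (trans (cong parity e') (parity-2*+bit (numʳ r') y))
    m≡m' : numʳ r ≡ numʳ r'
    m≡m' = trans (sym (half-2*+bit (numʳ r) x)) (trans (cong ⌊_/2⌋ e') (half-2*+bit (numʳ r') y))

  numʳ-surjective : ∀ n → 1 ≤ n → ∃ λ r → numʳ r ≡ n
  numʳ-surjective = <-rec (λ n → 1 ≤ n → ∃ λ r → numʳ r ≡ n) step
    where
    step : ∀ n → (∀ {m} → m < n → 1 ≤ m → ∃ λ r → numʳ r ≡ m) → 1 ≤ n → ∃ λ r → numʳ r ≡ n
    step (suc zero)    _   _ = [] , refl
    step (suc (suc n)) rec _ with rec (⌊n/2⌋<n (suc n)) (s≤s z≤n)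
    ... | r , e = parity (suc (suc n)) ∷ r ,
                  trans (numʳ-∷ _ r) (trans (cong (λ m → 2 * m + _) e) (2*half+parity (suc (suc n))))

  num-injective : ∀ a a' → num a ≡ num a' → a ≡ a'
  num-injective a a' e = reverse-injective (numʳ-injective (reverse a) (reverse a') e')
    where
    e' : numʳ (reverse a) ≡ numʳ (reverse a')
    e' = trans (cong num (reverse-involutive a)) (trans e (sym (cong num (reverse-involutive a'))))

  num-surjective : ∀ b → 1 ≤ b → ∃ λ a → num a ≡ b
  num-surjective b pos with numʳ-surjective b pos
  ... | r , e = reverse r , e

  flipIf : Bool → Bool → Bool
  flipIf true  x = not x
  flipIf false x = x

  flipIf-involutive : ∀ c x → flipIf c (flipIf c x) ≡ x
  flipIf-involutive true  x = not-involutive x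
  flipIf-involutive false x = refl

  flipIf-self : ∀ c → flipIf c c ≡ false
  flipIf-self true  = refl
  flipIf-self false = refl

  unflip : ∀ a {r' r} → map (flipIf false) a ++ r' ≈ r → a ++ r' ≈ r
  unflip a {r'} {r} = subst (λ t → t ++ r' ≈ r) (map-id a)

  readBits-step : ∀ c l x xs acc →
    readBits c (suc l) (x ∷ xs) acc ≡ readBits c l xs (2 * acc + bit (flipIf c x))
  readBits-step true  l x xs acc = refl
  readBits-step false l x xs acc = refl

  cI : List Bool → Word
  cI a = replicate (length a) false ++ true ∷ map not a

  cII : List Bool → Word
  cII a = replicate (length a) true ++ false ∷ a

  cI-++ : ∀ a r → cI a ++ r ≡ replicate (length a) false ++ true ∷ (map not a ++ r)
  cI-++ a r = ++-assoc (replicate (length a) false) (true ∷ map not a) r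

  cII-++ : ∀ a r → cII a ++ r ≡ replicate (length a) true ++ false ∷ (a ++ r)
  cII-++ a r = ++-assoc (replicate (length a) true) (false ∷ a) r

  replicate-shift : ∀ l (x : Bool) w → replicate (suc l) x ++ w ≡ replicate l x ++ x ∷ w
  replicate-shift zero    x w = refl
  replicate-shift (suc l) x w = cong (x ∷_) (replicate-shift l x w)

  -- One-pass versions of the decoders of Defs: `dI l w` decodes a C_I codeword
  -- of which l leading 0s have already been read, `dII l w` a C_II codeword of
  -- which l leading 1s have been read.  They are structural recursions on w.
  dI : ℕ → Word → CodeI
  dI l []          = aleph0
  dI l (false ∷ w) = dI (suc l) w
  dI l (true ∷ r)  = uncurry fin (readBits true l r 1)

  dII : ℕ → Word → ℕ × Word
  dII l []          = readBits false l [] 1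
  dII l (true ∷ w)  = dII (suc l) w
  dII l (false ∷ r) = readBits false l r 1

  -- decodeI and decodeII first split off the leading run with span=; what they
  -- do with the rest of the word:
  afterZeros : ℕ → Word → CodeI
  afterZeros l []      = aleph0
  afterZeros l (_ ∷ r) = uncurry fin (readBits true l r 1)

  afterOnes : ℕ → Word → ℕ × Word
  afterOnes l []      = readBits false l [] 1
  afterOnes l (_ ∷ r) = readBits false l r 1

  dI-afterZeros : ∀ l w → dI l w ≡ afterZeros (l + proj₁ (span= false w)) (proj₂ (span= false w))
  dI-afterZeros l []         = refl
  dI-afterZeros l (true ∷ r) = cong (λ k → uncurry fin (readBits true k r 1)) (sym (+-identityʳ l))
  dI-afterZeros l (false ∷ w) with span= false w | dI-afterZeros (suc l) w
  ... | (k , r) | e = trans e (cong (λ n → afterZeros n r) (sym (+-suc l k)))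

  dII-afterOnes : ∀ l w → dII l w ≡ afterOnes (l + proj₁ (span= true w)) (proj₂ (span= true w))
  dII-afterOnes l []          = cong (λ k → readBits false k [] 1) (sym (+-identityʳ l))
  dII-afterOnes l (false ∷ r) = cong (λ k → readBits false k r 1) (sym (+-identityʳ l))
  dII-afterOnes l (true ∷ w) with span= true w | dII-afterOnes (suc l) w
  ... | (k , r) | e = trans e (cong (λ n → afterOnes n r) (sym (+-suc l k)))

  decodeI≡dI : ∀ w → decodeI w ≡ dI 0 w
  decodeI≡dI w = trans (viaSpan w) (sym (dI-afterZeros 0 w))
    where
    viaSpan : ∀ w → decodeI w ≡ afterZeros (proj₁ (span= false w)) (proj₂ (span= false w))
    viaSpan w with span= false w
    ... | (l , [])    = refl
    ... | (l , _ ∷ r) with readBits true l r 1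
    ...   | (b , r') = refl

  decodeII≡dII : ∀ w → decodeII w ≡ dII 0 w
  decodeII≡dII w = trans (viaSpan w) (sym (dII-afterOnes 0 w))
    where
    viaSpan : ∀ w → decodeII w ≡ afterOnes (proj₁ (span= true w)) (proj₂ (span= true w))
    viaSpan w with span= true w
    ... | (l , [])    = refl
    ... | (l , _ ∷ r) = refl

  readBits-payload : ∀ c a s acc → readBits c (length a) (map (flipIf c) a ++ s) acc ≡ (numAcc acc a , s)
  readBits-payload c []      s acc = refl
  readBits-payload c (x ∷ a) s acc =
    trans (readBits-step c (length a) (flipIf c x) (map (flipIf c) a ++ s) acc)
          (subst (λ y → readBits c (length a) (map (flipIf c) a ++ s) (2 * acc + bit y) ≡ (numAcc acc (x ∷ a) , s))
                 (sym (flipIf-involutive c x)) (readBits-payload c a s (2 * acc + bit x)))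

  dI-skipZeros : ∀ l k w → dI l (replicate k false ++ w) ≡ dI (l + k) w
  dI-skipZeros l zero    w = cong (λ n → dI n w) (sym (+-identityʳ l))
  dI-skipZeros l (suc k) w = trans (dI-skipZeros (suc l) k w) (cong (λ n → dI n w) (sym (+-suc l k)))

  dII-skipOnes : ∀ l k w → dII l (replicate k true ++ w) ≡ dII (l + k) w
  dII-skipOnes l zero    w = cong (λ n → dII n w) (sym (+-identityʳ l))
  dII-skipOnes l (suc k) w = trans (dII-skipOnes (suc l) k w) (cong (λ n → dII n w) (sym (+-suc l k)))

  decodeI-cI : ∀ a s → decodeI (cI a ++ s) ≡ fin (num a) s
  decodeI-cI a s = begin
    decodeI (cI a ++ s)                                              ≡⟨ decodeI≡dI (cI a ++ s) ⟩
    dI 0 (cI a ++ s)                                                 ≡⟨ cong (dI 0) (cI-++ a s) ⟩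
    dI 0 (replicate (length a) false ++ true ∷ (map not a ++ s))     ≡⟨ dI-skipZeros 0 (length a) _ ⟩
    uncurry fin (readBits true (length a) (map not a ++ s) 1)       ≡⟨ cong (uncurry fin) (readBits-payload true a s 1) ⟩
    fin (num a) s                                                    ∎
    where open ≡-Reasoning

  decodeII-cII : ∀ a s → decodeII (cII a ++ s) ≡ (num a , s)
  decodeII-cII a s = begin
    decodeII (cII a ++ s)                                     ≡⟨ decodeII≡dII (cII a ++ s) ⟩
    dII 0 (cII a ++ s)                                        ≡⟨ cong (dII 0) (cII-++ a s) ⟩
    dII 0 (replicate (length a) true ++ false ∷ (a ++ s))     ≡⟨ dII-skipOnes 0 (length a) _ ⟩
    readBits false (length a) (a ++ s) 1                      ≡⟨ cong (λ t → readBits false (length a) (t ++ s) 1) (map-id a) ⟨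
    readBits false (length a) (map (flipIf false) a ++ s) 1   ≡⟨ readBits-payload false a s 1 ⟩
    (num a , s)                                               ∎
    where open ≡-Reasoning

  readBits-sound : ∀ c l r acc → ∃₂ λ a r' →
    readBits c l r acc ≡ (numAcc acc a , r') × length a ≡ l × map (flipIf c) a ++ r' ≈ r
  readBits-sound c zero r acc = [] , r , refl , refl , ≈-refl r
  readBits-sound c (suc l) [] acc with readBits-sound c l [] (2 * acc + bit c)
  ... | a , r' , eq , len , rel =
    c ∷ a , r' , eq , cong suc len ,
    zeros (subst (λ y → Zeros (y ∷ map (flipIf c) a ++ r')) (sym (flipIf-self c)) (0∷ Zeros-resp [] (≈-sym rel))) []
  readBits-sound c (suc l) (x ∷ xs) acc with readBits-sound c l xs (2 * acc + bit (flipIf c x))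
  ... | a , r' , eq , len , rel =
    flipIf c x ∷ a , r' , trans (readBits-step c l x xs acc) eq , cong suc len ,
    subst (λ y → y ∷ map (flipIf c) a ++ r' ≈ x ∷ xs) (sym (flipIf-involutive c x)) (x ∷ rel)

  cI-≈ : ∀ a r' l r → length a ≡ l → map not a ++ r' ≈ r → cI a ++ r' ≈ replicate l false ++ true ∷ r
  cI-≈ a r' .(length a) r refl rel =
    subst (_≈ _) (sym (cI-++ a r')) (≈-prefix (replicate (length a) false) (true ∷ rel))

  cII-≈ : ∀ a r' l r → length a ≡ l → a ++ r' ≈ r → cII a ++ r' ≈ replicate l true ++ false ∷ r
  cII-≈ a r' .(length a) r refl rel =
    subst (_≈ _) (sym (cII-++ a r')) (≈-prefix (replicate (length a) true) (false ∷ rel))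

  dI-aleph0-sound : ∀ l w → dI l w ≡ aleph0 → Zeros w
  dI-aleph0-sound l []          _ = []
  dI-aleph0-sound l (false ∷ w) e = 0∷ dI-aleph0-sound (suc l) w e
  dI-aleph0-sound l (true ∷ r)  e with readBits true l r 1
  dI-aleph0-sound l (true ∷ r)  () | _ , _

  dI-fin-sound : ∀ l w {b r} → dI l w ≡ fin b r → ∃ λ a → num a ≡ b × cI a ++ r ≈ replicate l false ++ w
  dI-fin-sound l []          ()
  dI-fin-sound l (false ∷ w) e with dI-fin-sound (suc l) w e
  ... | a , ea , rel = a , ea , subst (cI a ++ _ ≈_) (replicate-shift l false w) rel
  dI-fin-sound l (true ∷ r)  e with readBits-sound true l r 1
  ... | a , r' , eq , len , rel with trans (sym (cong (uncurry fin) eq)) e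
  ...   | refl = a , refl , cI-≈ a r' l r len rel

  dII-sound : ∀ l w {b r} → dII l w ≡ (b , r) → ∃ λ a → num a ≡ b × cII a ++ r ≈ replicate l true ++ w
  dII-sound l [] e with readBits-sound false l [] 1
  ... | a , r' , eq , len , rel with trans (sym eq) e
  ...   | refl = a , refl , ≈-trans (cII-≈ a r' l [] len (unflip a rel)) (≈-prefix (replicate l true) (zeros (0∷ []) []))
  dII-sound l (true ∷ w) e with dII-sound (suc l) w e
  ... | a , ea , rel = a , ea , subst (cII a ++ _ ≈_) (replicate-shift l true w) rel
  dII-sound l (false ∷ r) e with readBits-sound false l r 1
  ... | a , r' , eq , len , rel with trans (sym eq) e
  ...   | refl = a , refl , cII-≈ a r' l r len (unflip a rel)

  infix 4 _≈ᴿ_ _≈ᴵ_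
  _≈ᴿ_ : ℕ × Word → ℕ × Word → Set
  (b , r) ≈ᴿ (b' , r') = b ≡ b' × r ≈ r'

  _≈ᴵ_ : CodeI → CodeI → Set
  aleph0  ≈ᴵ aleph0    = ⊤
  fin b r ≈ᴵ fin b' r' = (b , r) ≈ᴿ (b' , r')
  _       ≈ᴵ _         = ⊥

  ≈ᴿ-trans : ∀ {p q s} → p ≈ᴿ q → q ≈ᴿ s → p ≈ᴿ s
  ≈ᴿ-trans (e , f) (e' , f') = trans e e' , ≈-trans f f'

  ≈ᴿ-sym : ∀ {p q} → p ≈ᴿ q → q ≈ᴿ p
  ≈ᴿ-sym (e , f) = sym e , ≈-sym f

  readBits-zeros : ∀ c l {u} acc → Zeros u → readBits c l u acc ≈ᴿ readBits c l [] acc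
  readBits-zeros c zero    acc zu     = refl , zeros zu []
  readBits-zeros c (suc l) acc []     = refl , ≈-refl _
  readBits-zeros c (suc l) {false ∷ u} acc (0∷ zu) =
    subst (λ y → readBits c (suc l) (false ∷ u) acc ≈ᴿ readBits c l [] (2 * acc + bit y)) (flipIf-false c)
      (subst (_≈ᴿ _) (sym (readBits-step c l false u acc)) (readBits-zeros c l _ zu))
    where
    flipIf-false : ∀ c → flipIf c false ≡ c
    flipIf-false true  = refl
    flipIf-false false = refl

  readBits-resp : ∀ c l {u w} acc → u ≈ w → readBits c l u acc ≈ᴿ readBits c l w acc
  readBits-resp c l acc (zeros zu zw) = ≈ᴿ-trans (readBits-zeros c l acc zu) (≈ᴿ-sym (readBits-zeros c l acc zw))
  readBits-resp c zero    acc (x ∷ e) = refl , x ∷ e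
  readBits-resp c (suc l) {x ∷ u} {.x ∷ w} acc (x ∷ e)
    rewrite readBits-step c l x u acc | readBits-step c l x w acc = readBits-resp c l _ e

  dI-zeros : ∀ l {u} → Zeros u → dI l u ≡ aleph0
  dI-zeros l []     = refl
  dI-zeros l (0∷ z) = dI-zeros (suc l) z

  dI-resp : ∀ l {u w} → u ≈ w → dI l u ≈ᴵ dI l w
  dI-resp l (zeros zu zw) rewrite dI-zeros l zu | dI-zeros l zw = tt
  dI-resp l (false ∷ e) = dI-resp (suc l) e
  dI-resp l (true ∷ e)  = readBits-resp true l 1 e

  dII-resp : ∀ l {u w} → u ≈ w → dII l u ≈ᴿ dII l w
  dII-resp l (zeros zu zw) = ≈ᴿ-trans (dII-zeros zu) (≈ᴿ-sym (dII-zeros zw))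
    where
    dII-zeros : ∀ {u} → Zeros u → dII l u ≈ᴿ readBits false l [] 1
    dII-zeros []     = refl , ≈-refl _
    dII-zeros (0∷ z) = readBits-resp false l 1 (zeros z [])
  dII-resp l (true ∷ e)  = dII-resp (suc l) e
  dII-resp l (false ∷ e) = readBits-resp false l 1 e

  decodeI-resp : ∀ {u w} → u ≈ w → decodeI u ≈ᴵ decodeI w
  decodeI-resp {u} {w} e rewrite decodeI≡dI u | decodeI≡dI w = dI-resp 0 e

  decodeII-resp : ∀ {u w} → u ≈ w → decodeII u ≈ᴿ decodeII w
  decodeII-resp {u} {w} e rewrite decodeII≡dII u | decodeII≡dII w = dII-resp 0 e

  decomposeFrom : ℕ → CodeI → List ℕ
  decomposeFrom f aleph0    = []
  decomposeFrom f (fin b r) = b ∷ proj₁ (decodeII r) ∷ decompose f (proj₂ (decodeII r))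

  decompose-suc : ∀ f w → decompose (suc f) w ≡ decomposeFrom f (decodeI w)
  decompose-suc f w with decodeI w
  ... | aleph0  = refl
  ... | fin b r with decodeII r
  ...   | (b' , r') = refl

  decompose-resp : ∀ f {u w} → u ≈ w → decompose f u ≡ decompose f w
  decompose-resp zero    e = refl
  decompose-resp (suc f) {u} {w} e rewrite decompose-suc f u | decompose-suc f w = from (decodeI-resp e)
    where
    from : ∀ {c c'} → c ≈ᴵ c' → decomposeFrom f c ≡ decomposeFrom f c'
    from {aleph0}  {aleph0}     _          = refl
    from {fin b r} {fin .b r'} (refl , er) with decodeII r | decodeII r' | decodeII-resp er
    ... | (x , y) | (.x , y') | (refl , ey) = cong (λ t → b ∷ x ∷ t) (decompose-resp f ey)

  -- A decomposition C_I(b₁) C_II(b₂) ... C_I(b_{2l-1}) C_II(b_{2l}), given by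
  -- the payloads of its codewords, and its digit sequence b₁ … b_{2l}.
  Pairs : Set
  Pairs = List (List Bool × List Bool)

  encode : Pairs → Word
  encode []              = []
  encode ((a , a') ∷ ps) = cI a ++ cII a' ++ encode ps

  digits : Pairs → List ℕ
  digits []              = []
  digits ((a , a') ∷ ps) = num a ∷ num a' ∷ digits ps

  decompose-encode : ∀ f ps → length ps ≤ f → decompose f (encode ps) ≡ digits ps
  decompose-encode zero    []              _ = refl
  decompose-encode (suc f) []              _ = refl
  decompose-encode (suc f) ((a , a') ∷ ps) (s≤s le)
    rewrite decodeI-cI a (cII a' ++ encode ps) | decodeII-cII a' (encode ps) | decompose-encode f ps le = refl

  -- Each C_I codeword contains a 1, so an encoding of length n has ≥ n ones.
  ones-skipZeros : ∀ n y → ones (replicate n false ++ y) ≡ ones y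
  ones-skipZeros zero    y = refl
  ones-skipZeros (suc n) y = ones-skipZeros n y

  ones-cI : ∀ a r → ones r < ones (cI a ++ r)
  ones-cI a r rewrite cI-++ a r | ones-skipZeros (length a) (true ∷ map not a ++ r) = s≤s (ones-suffix (map not a) r)

  length≤ones : ∀ ps → length ps ≤ ones (encode ps)
  length≤ones []              = z≤n
  length≤ones ((a , a') ∷ ps) =
    <-≤-trans (s≤s (length≤ones ps)) (<-≤-trans (s≤s (ones-suffix (cII a') (encode ps))) (ones-cI a (cII a' ++ encode ps)))

  decompose-sound : ∀ f w → ones w < f → ∃ λ ps → digits ps ≡ decompose f w × encode ps ≈ w
  decompose-sound (suc f) w (s≤s lt) with decodeI w in eqI
  ... | aleph0 = [] , refl , zeros [] (dI-aleph0-sound 0 w (trans (sym (decodeI≡dI w)) eqI))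
  ... | fin b r with decodeII r in eqII
  ...   | (b' , r') with dI-fin-sound 0 w (trans (sym (decodeI≡dI w)) eqI) | dII-sound 0 r (trans (sym (decodeII≡dII r)) eqII)
  ...     | (a , ea , relI) | (a' , ea' , relII) with decompose-sound f r' fuel
    where
    fuel : ones r' < f
    fuel = ≤-<-trans (ones-suffix (cII a') r')
             (subst (_< f) (sym (ones-≈ relII)) (<-≤-trans (ones-cI a r) (subst (_≤ f) (sym (ones-≈ relI)) lt)))
  ...       | (ps , eps , rel) =
    (a , a') ∷ ps , trans (cong₂ (λ x y → x ∷ y ∷ digits ps) ea ea') (cong (λ t → b ∷ b' ∷ t) eps) ,
    ≈-trans (≈-prefix (cI a) (≈-prefix (cII a') rel)) (≈-trans (≈-prefix (cI a) relII) relI)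

  -- Parity of the length of a digit sequence (true = even).
  isEven : List ℕ → Bool
  isEven []       = true
  isEven (_ ∷ xs) = not (isEven xs)

  AllPositive : List ℕ → Set
  AllPositive = All (1 ≤_)

  -- The digit sequences [b₁,…,b_{2l}] occurring in the definition of ?_V⁻¹.
  record Admissible (L : List ℕ) : Set where
    field
      allPositive : AllPositive L
      evenLength  : isEven L ≡ true
      nonempty    : L ≡ [] → ⊥

  digits-positive : ∀ ps → AllPositive (digits ps)
  digits-positive []              = []
  digits-positive ((a , a') ∷ ps) = numAcc-≥ 1 a ∷ numAcc-≥ 1 a' ∷ digits-positive ps

  digits-even : ∀ ps → isEven (digits ps) ≡ true
  digits-even []             = refl
  digits-even (_ ∷ ps) rewrite digits-even ps = refl

  digits-injective : ∀ ps qs → digits ps ≡ digits qs → ps ≡ qs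
  digits-injective []              []              _ = refl
  digits-injective ((a , a') ∷ ps) ((c , c') ∷ qs) e with ∷-injective e
  ... | ea , e' with ∷-injective e'
  ...   | ea' , eps = cong₂ _∷_ (cong₂ _,_ (num-injective a c ea) (num-injective a' c' ea')) (digits-injective ps qs eps)

  digits-surjective : ∀ L → AllPositive L → isEven L ≡ true → ∃ λ ps → digits ps ≡ L
  digits-surjective []              _                 _  = [] , refl
  digits-surjective (b ∷ [])        _                 ()
  digits-surjective (b ∷ b' ∷ L) (pb ∷ pb' ∷ pL) ev
    with num-surjective b pb | num-surjective b' pb' | digits-surjective L pL (trans (sym (not-involutive (isEven L))) ev)
  ... | a , ea | a' , ea' | ps , eps = (a , a') ∷ ps , cong₂ _∷_ ea (cong₂ _∷_ ea' eps)

  digitsOf : Word → List ℕ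
  digitsOf v = decompose (suc (length (v ++ true ∷ []))) (v ++ true ∷ [])

  digitsOf-decomposition : ∀ v → ∃ λ ps → digits ps ≡ digitsOf v × encode ps ≈ v ++ true ∷ []
  digitsOf-decomposition v = decompose-sound _ (v ++ true ∷ []) (s≤s (ones≤length (v ++ true ∷ [])))

  digitsOf-admissible : ∀ v → Admissible (digitsOf v)
  digitsOf-admissible v with digitsOf-decomposition v
  ... | ps , e , rel = record
    { allPositive = subst AllPositive e (digits-positive ps)
    ; evenLength  = trans (cong isEven (sym e)) (digits-even ps)
    ; nonempty    = nonempty ps e rel
    }
    where
    nonempty : ∀ ps → digits ps ≡ digitsOf v → encode ps ≈ v ++ true ∷ [] → digitsOf v ≡ [] → ⊥
    nonempty []      _ rel _  = ¬Zeros-1 v [] (Zeros-resp [] rel)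
    nonempty (_ ∷ _) e _   e₀ with trans e e₀
    ... | ()

  digitsOf-injective : ∀ {v v'} → digitsOf v ≡ digitsOf v' → v ≡ v'
  digitsOf-injective {v} {v'} e with digitsOf-decomposition v | digitsOf-decomposition v'
  ... | ps , eps , rel | ps' , eps' , rel' with digits-injective ps ps' (trans eps (trans e (sym eps')))
  ... | refl = ≈-cancel-1 v v' (≈-trans (≈-sym rel) rel')

  -- Every admissible sequence arises: encode it, and cut the encoding after its
  -- last 1 (which exists since a C_I codeword contains a 1).
  digitsOf-surjective : ∀ L → Admissible L → ∃ λ v → digitsOf v ≡ L
  digitsOf-surjective L adm with digits-surjective L allPositive evenLength
    where open Admissible adm
  ... | [] , e = ⊥-elim (Admissible.nonempty adm (sym e))
  ... | ps@((a , a') ∷ qs) , e with lastOne (encode ps)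
  ...   | inj₁ z = ⊥-elim (¬Zeros-1 (replicate (length a) false) _ (subst Zeros (cI-++ a (cII a' ++ encode qs)) z))
  ...   | inj₂ (v , k , ev) = v , trans (decompose-resp _ v1≈enc) (trans (decompose-encode _ ps enoughFuel) e)
    where
    v1≈enc : v ++ true ∷ [] ≈ encode ps
    v1≈enc = subst (v ++ true ∷ [] ≈_) (sym ev) (≈-prefix v (true ∷ zeros [] (Zeros-replicate k)))
    enoughFuel : length ps ≤ suc (length (v ++ true ∷ []))
    enoughFuel = ≤-trans (length≤ones ps)
                   (≤-trans (≤-reflexive (ones-≈ (≈-sym v1≈enc))) (m≤n⇒m≤1+n (ones≤length (v ++ true ∷ []))))

module ContinuedFractions where

  open import Defs
  open Decomposition using (isEven; AllPositive)
  open import Data.Bool using (Bool; true; false; not)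
  open import Data.Bool.Properties using (not-involutive; not-injective)
  open import Data.Nat as ℕ using (ℕ; zero; suc)
  import Data.Nat.Properties as ℕ
  open import Data.Nat.DivMod using (_%_; m≡m%n+[m/n]*n; m%n<n; m≥n⇒m/n>0) renaming (_/_ to _div_)
  open import Data.Nat.Induction using (<-rec)
  open import Data.Nat.Tactic.RingSolver using (solve-∀)
  open import Data.Integer using (+_; -[1+_])
  open import Data.Integer.Properties using (pos-*; pos-+)
  open import Data.Rational
  open import Data.Rational.Properties
  open import Data.Rational.Unnormalised as ℚᵘ using (mkℚᵘ; *≡*) renaming (_≃_ to _≃ᵘ_; _+_ to _+ᵘ_; _*_ to _*ᵘ_)
  import Data.Rational.Unnormalised.Properties as ℚᵘ
  open import Algebra.Properties.Group +-0-group using (∙-cancelˡ)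
  open import Data.List using ([]; _∷_)
  open import Data.List.Relation.Unary.All using ([]; _∷_)
  open import Data.Product using (_×_; _,_; ∃)
  open import Data.Empty using (⊥; ⊥-elim)
  open import Relation.Binary.PropositionalEquality
  open import Relation.Binary.Definitions using (tri<; tri≈; tri>)

  recip-1/ : ∀ x (p : 0ℚ < x) → recipℚ x ≡ (1/ x) {{pos⇒nonZero x {{positive p}}}}
  recip-1/ (mkℚ (+ zero) d c) p with positive p
  ... | ()
  recip-1/ x@(mkℚ (+ suc n) d c) p = ↥p/↧p≡p ((1/ x) {{pos⇒nonZero x {{positive p}}}})
  recip-1/ (mkℚ -[1+ n ] d c) p with positive p
  ... | ()

  module _ (x : ℚ) (p : 0ℚ < x) where
    private instance
      x≢0 : NonZero x
      x≢0 = pos⇒nonZero x {{positive p}}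
      x>0 : Positive x
      x>0 = positive p

    recip-positive : 0ℚ < recipℚ x
    recip-positive rewrite recip-1/ x p = positive⁻¹ (1/ x) {{1/pos⇒pos x}}

    recip-inverse : x * recipℚ x ≡ 1ℚ
    recip-inverse rewrite recip-1/ x p = *-inverseʳ x

    recip-unique : ∀ y → x * y ≡ 1ℚ → recipℚ x ≡ y
    recip-unique y e rewrite recip-1/ x p = begin
      1/ x              ≡⟨ *-identityʳ (1/ x) ⟨
      1/ x * 1ℚ         ≡⟨ cong (1/ x *_) e ⟨
      1/ x * (x * y)    ≡⟨ *-assoc (1/ x) x y ⟨
      (1/ x * x) * y    ≡⟨ cong (_* y) (*-inverseˡ x) ⟩
      1ℚ * y            ≡⟨ *-identityˡ y ⟩
      y                 ∎
      where open ≡-Reasoning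

  recip-involutive : ∀ x → 0ℚ < x → recipℚ (recipℚ x) ≡ x
  recip-involutive x p =
    recip-unique (recipℚ x) (recip-positive x p) x (trans (*-comm (recipℚ x) x) (recip-inverse x p))

  recip-injective : ∀ x y → 0ℚ < x → 0ℚ < y → recipℚ x ≡ recipℚ y → x ≡ y
  recip-injective x y p q e = trans (sym (recip-involutive x p)) (trans (cong recipℚ e) (recip-involutive y q))

  recip-antitone-≤ : ∀ x y → 0ℚ < x → x ≤ y → recipℚ y ≤ recipℚ x
  recip-antitone-≤ x y p x≤y = begin
    ry               ≡⟨ *-identityˡ ry ⟨
    1ℚ * ry          ≡⟨ cong (_* ry) (trans (*-comm rx x) (recip-inverse x p)) ⟨
    (rx * x) * ry    ≤⟨ *-monoʳ-≤-nonNeg ry {{recip-nonNeg y y>0}} (*-monoˡ-≤-nonNeg rx {{recip-nonNeg x p}} x≤y) ⟩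
    (rx * y) * ry    ≡⟨ *-assoc rx y ry ⟩
    rx * (y * ry)    ≡⟨ cong (rx *_) (recip-inverse y y>0) ⟩
    rx * 1ℚ          ≡⟨ *-identityʳ rx ⟩
    rx               ∎
    where
    open ≤-Reasoning
    rx = recipℚ x
    ry = recipℚ y
    y>0 : 0ℚ < y
    y>0 = <-≤-trans p x≤y
    recip-nonNeg : ∀ z → 0ℚ < z → NonNegative (recipℚ z)
    recip-nonNeg z z>0 = nonNegative (<⇒≤ (recip-positive z z>0))

  recip-antitone-< : ∀ x y → 0ℚ < x → x < y → recipℚ y < recipℚ x
  recip-antitone-< x y p x<y with <-cmp (recipℚ y) (recipℚ x)
  ... | tri< lt _ _ = lt
  ... | tri≈ _ eq _ = ⊥-elim (<-irrefl (recip-injective x y p (<-trans p x<y) (sym eq)) x<y)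
  ... | tri> _ _ gt = ⊥-elim (<-irrefl refl (<-≤-trans gt (recip-antitone-≤ x y p (<⇒≤ x<y))))

  nat : ℕ → ℚ
  nat b = + b / 1

  -- Identities between fractions are checked in ℚᵘ, where they reduce to
  -- identities between natural numbers.
  toℚᵘ-fraction : ∀ i n → toℚᵘ (i / suc n) ≃ᵘ mkℚᵘ i n
  toℚᵘ-fraction i n = toℚᵘ-fromℚᵘ (mkℚᵘ i n)

  +ᵘ-fractions : ∀ a x c y → mkℚᵘ (+ a) x +ᵘ mkℚᵘ (+ c) y ≡ mkℚᵘ (+ (a ℕ.* suc y ℕ.+ c ℕ.* suc x)) (y ℕ.+ x ℕ.* suc y)
  +ᵘ-fractions a x c y = cong (λ t → mkℚᵘ t (y ℕ.+ x ℕ.* suc y))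
    (trans (cong₂ Data.Integer._+_ (sym (pos-* a (suc y))) (sym (pos-* c (suc x)))) (sym (pos-+ (a ℕ.* suc y) (c ℕ.* suc x))))
    where import Data.Integer

  *ᵘ-fractions : ∀ a x c y → mkℚᵘ (+ a) x *ᵘ mkℚᵘ (+ c) y ≡ mkℚᵘ (+ (a ℕ.* c)) (y ℕ.+ x ℕ.* suc y)
  *ᵘ-fractions a x c y = cong (λ t → mkℚᵘ t (y ℕ.+ x ℕ.* suc y)) (sym (pos-* a c))

  ≃ᵘ-fractions : ∀ a x c y → a ℕ.* suc y ≡ c ℕ.* suc x → mkℚᵘ (+ a) x ≃ᵘ mkℚᵘ (+ c) y
  ≃ᵘ-fractions a x c y e = *≡* (trans (sym (pos-* a (suc y))) (trans (cong +_ e) (pos-* c (suc x))))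

  nat-suc : ∀ b → nat (suc b) ≡ 1ℚ + nat b
  nat-suc b = toℚᵘ-injective (begin
    toℚᵘ (nat (suc b))                              ≈⟨ toℚᵘ-fraction (+ suc b) 0 ⟩
    mkℚᵘ (+ suc b) 0                                ≈⟨ ≃ᵘ-fractions (suc b) 0 _ _ (lemma b) ⟩
    mkℚᵘ (+ (1 ℕ.* 1 ℕ.+ b ℕ.* 1)) (0 ℕ.+ 0 ℕ.* 1)  ≡⟨ +ᵘ-fractions 1 0 b 0 ⟨
    mkℚᵘ (+ 1) 0 +ᵘ mkℚᵘ (+ b) 0                    ≈⟨ ℚᵘ.+-cong (ℚᵘ.≃-refl {mkℚᵘ (+ 1) 0}) (ℚᵘ.≃-sym (toℚᵘ-fraction (+ b) 0)) ⟩
    toℚᵘ 1ℚ +ᵘ toℚᵘ (nat b)                         ≈⟨ toℚᵘ-homo-+ 1ℚ (nat b) ⟨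
    toℚᵘ (1ℚ + nat b)                               ∎)
    where
    open ℚᵘ.≃-Reasoning
    lemma : ∀ b → (1 ℕ.+ b) ℕ.* 1 ≡ (1 ℕ.* 1 ℕ.+ b ℕ.* 1) ℕ.* 1
    lemma = solve-∀

  -- The Euclidean step: if D = b·N + r then N/D = 1 / (b + r/N).
  euclid-step : ∀ b r n d → suc d ≡ b ℕ.* suc n ℕ.+ r → (nat b + + r / suc n) * (+ suc n / suc d) ≡ 1ℚ
  euclid-step b r n d e = toℚᵘ-injective (begin
    toℚᵘ ((nat b + + r / suc n) * (+ suc n / suc d))
      ≈⟨ toℚᵘ-homo-* (nat b + + r / suc n) (+ suc n / suc d) ⟩
    toℚᵘ (nat b + + r / suc n) *ᵘ toℚᵘ (+ suc n / suc d)
      ≈⟨ ℚᵘ.*-cong (ℚᵘ.≃-trans (toℚᵘ-homo-+ (nat b) (+ r / suc n)) (ℚᵘ.+-cong (toℚᵘ-fraction (+ b) 0) (toℚᵘ-fraction (+ r) n)))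
                   (toℚᵘ-fraction (+ suc n) d) ⟩
    (mkℚᵘ (+ b) 0 +ᵘ mkℚᵘ (+ r) n) *ᵘ mkℚᵘ (+ suc n) d
      ≡⟨ cong (_*ᵘ mkℚᵘ (+ suc n) d) (+ᵘ-fractions b 0 r n) ⟩
    mkℚᵘ (+ (b ℕ.* suc n ℕ.+ r ℕ.* 1)) (n ℕ.+ 0 ℕ.* suc n) *ᵘ mkℚᵘ (+ suc n) d
      ≡⟨ *ᵘ-fractions (b ℕ.* suc n ℕ.+ r ℕ.* 1) (n ℕ.+ 0 ℕ.* suc n) (suc n) d ⟩
    mkℚᵘ (+ ((b ℕ.* suc n ℕ.+ r ℕ.* 1) ℕ.* suc n)) (d ℕ.+ (n ℕ.+ 0 ℕ.* suc n) ℕ.* suc d)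
      ≈⟨ ≃ᵘ-fractions _ _ 1 0 (trans (lemma b r n) (cong (λ D → 1 ℕ.* ((1 ℕ.+ (n ℕ.+ 0 ℕ.* (1 ℕ.+ n))) ℕ.* D)) (sym e))) ⟩
    toℚᵘ 1ℚ ∎)
    where
    open ℚᵘ.≃-Reasoning
    lemma : ∀ b r n → ((b ℕ.* (1 ℕ.+ n) ℕ.+ r ℕ.* 1) ℕ.* (1 ℕ.+ n)) ℕ.* 1
                      ≡ 1 ℕ.* ((1 ℕ.+ (n ℕ.+ 0 ℕ.* (1 ℕ.+ n))) ℕ.* (b ℕ.* (1 ℕ.+ n) ℕ.+ r))
    lemma = solve-∀

  ≤-+nonNeg : ∀ a c → 0ℚ ≤ c → a ≤ a + c
  ≤-+nonNeg a c c≥0 = subst (_≤ a + c) (+-identityʳ a) (+-monoʳ-≤ a c≥0)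

  +-cancelˡ-≤ : ∀ a s t → a + s ≤ a + t → s ≤ t
  +-cancelˡ-≤ a s t le = subst₂ _≤_ (cancel s) (cancel t) (+-monoʳ-≤ (- a) le)
    where
    cancel : ∀ s → - a + (a + s) ≡ s
    cancel s = trans (sym (+-assoc (- a) a s)) (trans (cong (_+ s) (+-inverseˡ a)) (+-identityˡ s))

  0<1 : 0ℚ < 1ℚ
  0<1 = positive⁻¹ 1ℚ

  nat-nonNeg : ∀ b → 0ℚ ≤ nat b
  nat-nonNeg zero    = ≤-refl
  nat-nonNeg (suc b) = subst (0ℚ ≤_) (sym (nat-suc b))
    (≤-trans (nat-nonNeg b) (subst (_≤ 1ℚ + nat b) (+-identityˡ (nat b)) (+-monoˡ-≤ (nat b) (<⇒≤ 0<1))))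

  nat-≥1 : ∀ b → 1 ℕ.≤ b → 1ℚ ≤ nat b
  nat-≥1 (suc b) _ = subst (1ℚ ≤_) (sym (nat-suc b)) (≤-+nonNeg 1ℚ (nat b) (nat-nonNeg b))

  nat-mono : ∀ {b c} → b ℕ.≤ c → nat b ≤ nat c
  nat-mono {zero}  {c}     _           = nat-nonNeg c
  nat-mono {suc b} {suc c} (ℕ.s≤s le) = subst₂ _≤_ (sym (nat-suc b)) (sym (nat-suc c)) (+-monoʳ-≤ 1ℚ (nat-mono le))

  nat-<⇒+1≤ : ∀ {b c} → b ℕ.< c → 1ℚ + nat b ≤ nat c
  nat-<⇒+1≤ {b} {suc c} (ℕ.s≤s le) = subst (1ℚ + nat b ≤_) (sym (nat-suc c)) (+-monoʳ-≤ 1ℚ (nat-mono le))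

  nat-injective-0 : ∀ b → nat b ≡ 0ℚ → b ≡ 0
  nat-injective-0 zero    _ = refl
  nat-injective-0 (suc b) e = ⊥-elim (<-irrefl (sym e) (<-≤-trans 0<1 (nat-≥1 (suc b) (ℕ.s≤s ℕ.z≤n))))

  cf-nonNeg      : ∀ L → AllPositive L → 0ℚ ≤ cf L
  cf-denominator : ∀ b bs → 1 ℕ.≤ b → AllPositive bs → 1ℚ ≤ nat b + cf bs

  cf-denominator b bs pb pbs = ≤-trans (nat-≥1 b pb) (≤-+nonNeg (nat b) (cf bs) (cf-nonNeg bs pbs))

  cf-positive : ∀ b bs → 1 ℕ.≤ b → AllPositive bs → 0ℚ < cf (b ∷ bs)
  cf-positive b bs pb pbs = recip-positive (nat b + cf bs) (<-≤-trans 0<1 (cf-denominator b bs pb pbs))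

  cf-nonNeg []       _         = ≤-refl
  cf-nonNeg (b ∷ bs) (pb ∷ pbs) = <⇒≤ (cf-positive b bs pb pbs)

  cf-≤1 : ∀ L → AllPositive L → cf L ≤ 1ℚ
  cf-≤1 []       _         = <⇒≤ 0<1
  cf-≤1 (b ∷ bs) (pb ∷ pbs) = recip-antitone-≤ 1ℚ (nat b + cf bs) 0<1 (cf-denominator b bs pb pbs)

  cf≡0 : ∀ L → AllPositive L → cf L ≡ 0ℚ → L ≡ []
  cf≡0 []       _         _ = refl
  cf≡0 (b ∷ bs) (pb ∷ pbs) e = ⊥-elim (<-irrefl (sym e) (cf-positive b bs pb pbs))

  cf-∷-injective : ∀ b bs c cs → AllPositive (b ∷ bs) → AllPositive (c ∷ cs) →
                   cf (b ∷ bs) ≡ cf (c ∷ cs) → nat b + cf bs ≡ nat c + cf cs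
  cf-∷-injective b bs c cs (pb ∷ pbs) (pc ∷ pcs) =
    recip-injective _ _ (<-≤-trans 0<1 (cf-denominator b bs pb pbs)) (<-≤-trans 0<1 (cf-denominator c cs pc pcs))

  cf≡1 : ∀ L → AllPositive L → cf L ≡ 1ℚ → L ≡ 1 ∷ []
  cf≡1 [] _ ()
  cf≡1 (suc b ∷ bs) (pb ∷ pbs) e = cong₂ _∷_ (cong suc (nat-injective-0 b b≡0)) (cf≡0 bs pbs bs≡0)
    where
    denominator≡1 : nat (suc b) + cf bs ≡ 1ℚ
    denominator≡1 = cf-∷-injective (suc b) bs 1 [] (pb ∷ pbs) (ℕ.s≤s ℕ.z≤n ∷ []) e
    rest≡0 : nat b + cf bs ≡ 0ℚ
    rest≡0 = ∙-cancelˡ 1ℚ (nat b + cf bs) 0ℚ (begin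
      1ℚ + (nat b + cf bs)   ≡⟨ +-assoc 1ℚ (nat b) (cf bs) ⟨
      (1ℚ + nat b) + cf bs   ≡⟨ cong (_+ cf bs) (nat-suc b) ⟨
      nat (suc b) + cf bs    ≡⟨ denominator≡1 ⟩
      1ℚ                     ≡⟨ +-identityʳ 1ℚ ⟨
      1ℚ + 0ℚ                ∎)
      where open ≡-Reasoning
    b≡0 : nat b ≡ 0ℚ
    b≡0 = ≤-antisym (subst (nat b ≤_) rest≡0 (≤-+nonNeg (nat b) (cf bs) (cf-nonNeg bs pbs))) (nat-nonNeg b)
    bs≡0 : cf bs ≡ 0ℚ
    bs≡0 = ≤-antisym (subst (cf bs ≤_) (trans (+-comm (cf bs) (nat b)) rest≡0) (≤-+nonNeg (cf bs) (nat b) (nat-nonNeg b)))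
                     (cf-nonNeg bs pbs)

  -- If b < c and b + cf bs = c + cf cs, then cf bs = 1 and cf cs = 0, i.e.
  -- [b,1] = [c] with b + 1 = c: the two expansions have different parity.
  cf-first-digits : ∀ b bs c cs → AllPositive bs → AllPositive cs → b ℕ.< c →
                    nat b + cf bs ≡ nat c + cf cs → bs ≡ 1 ∷ [] × cs ≡ []
  cf-first-digits b bs c cs pbs pcs b<c e = cf≡1 bs pbs x≡1 , cf≡0 cs pcs y≡0
    where
    x = cf bs
    y = cf cs
    1+y≤x : 1ℚ + y ≤ x
    1+y≤x = +-cancelˡ-≤ (nat b) (1ℚ + y) x
              (subst₂ _≤_ (trans (cong (_+ y) (+-comm 1ℚ (nat b))) (+-assoc (nat b) 1ℚ y)) (sym e)
                      (+-monoˡ-≤ y (nat-<⇒+1≤ b<c)))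
    y≡0 : y ≡ 0ℚ
    y≡0 = ≤-antisym (+-cancelˡ-≤ 1ℚ y 0ℚ (subst (1ℚ + y ≤_) (sym (+-identityʳ 1ℚ)) (≤-trans 1+y≤x (cf-≤1 bs pbs))))
                    (cf-nonNeg cs pcs)
    x≡1 : x ≡ 1ℚ
    x≡1 = ≤-antisym (cf-≤1 bs pbs) (≤-trans (≤-+nonNeg 1ℚ y (cf-nonNeg cs pcs)) 1+y≤x)

  cf-injective : ∀ L M → AllPositive L → AllPositive M → isEven L ≡ isEven M → cf L ≡ cf M → L ≡ M
  cf-injective []       []       _          _          _  _ = refl
  cf-injective []       (c ∷ cs) _          (pc ∷ pcs) _  e = ⊥-elim (<-irrefl e (cf-positive c cs pc pcs))
  cf-injective (b ∷ bs) []       (pb ∷ pbs) _          _  e = ⊥-elim (<-irrefl (sym e) (cf-positive b bs pb pbs))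
  cf-injective (b ∷ bs) (c ∷ cs) (pb ∷ pbs) (pc ∷ pcs) pe e with ℕ.<-cmp b c
  ... | tri< b<c _ _ = ⊥-elim (parity-mismatch pe (cf-first-digits b bs c cs pbs pcs b<c denominators))
    where
    denominators = cf-∷-injective b bs c cs (pb ∷ pbs) (pc ∷ pcs) e
    parity-mismatch : isEven (b ∷ bs) ≡ isEven (c ∷ cs) → bs ≡ 1 ∷ [] × cs ≡ [] → ⊥
    parity-mismatch () (refl , refl)
  ... | tri> _ _ c<b = ⊥-elim (parity-mismatch pe (cf-first-digits c cs b bs pcs pbs c<b (sym denominators)))
    where
    denominators = cf-∷-injective b bs c cs (pb ∷ pbs) (pc ∷ pcs) e
    parity-mismatch : isEven (b ∷ bs) ≡ isEven (c ∷ cs) → cs ≡ 1 ∷ [] × bs ≡ [] → ⊥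
    parity-mismatch () (refl , refl)
  ... | tri≈ _ refl _ = cong (b ∷_) (cf-injective bs cs pbs pcs (not-injective pe)
                                      (∙-cancelˡ (nat b) (cf bs) (cf cs) (cf-∷-injective b bs b cs (pb ∷ pbs) (pc ∷ pcs) e)))

  cf-split-last : ∀ b → cf (b ∷ 1 ∷ []) ≡ cf (suc b ∷ [])
  cf-split-last b = cong recipℚ (begin
    nat b + 1ℚ         ≡⟨ +-comm (nat b) 1ℚ ⟩
    1ℚ + nat b         ≡⟨ nat-suc b ⟨
    nat (suc b)        ≡⟨ +-identityʳ (nat (suc b)) ⟨
    nat (suc b) + 0ℚ   ∎)
    where open ≡-Reasoning

  cf-euclid-∷ : ∀ b r n d L' → suc d ≡ b ℕ.* suc n ℕ.+ r → 1 ℕ.≤ b → AllPositive L' →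
                cf L' ≡ + r / suc n → cf (b ∷ L') ≡ + suc n / suc d
  cf-euclid-∷ b r n d L' D≡ pb pL' e =
    recip-unique (nat b + cf L') (<-≤-trans 0<1 (cf-denominator b L' pb pL')) (+ suc n / suc d)
      (trans (cong (λ t → (nat b + t) * (+ suc n / suc d)) e) (euclid-step b r n d D≡))

  -- Existence of expansions (Euclid's algorithm): every fraction N/D with
  -- 0 < N < D is cf L for a nonempty positive L, of either length parity; the
  -- parity can be chosen because the last digit is ≥ 2 and [.., b] = [.., b-1, 1].
  Expansion : ℕ → ℕ → Bool → Set
  Expansion n d p = ∃ λ L → AllPositive L × isEven L ≡ p × (L ≡ [] → ⊥) × cf L ≡ + suc n / suc d

  cf-expansion-last : ∀ b n d p → suc d ≡ suc (suc b) ℕ.* suc n ℕ.+ 0 → Expansion n d p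
  cf-expansion-last b n d false D≡ =
    suc (suc b) ∷ [] , ℕ.s≤s ℕ.z≤n ∷ [] , refl , (λ ()) ,
    cf-euclid-∷ (suc (suc b)) 0 n d [] D≡ (ℕ.s≤s ℕ.z≤n) [] (sym (0/n≡0 (suc n)))
  cf-expansion-last b n d true D≡ =
    suc b ∷ 1 ∷ [] , ℕ.s≤s ℕ.z≤n ∷ ℕ.s≤s ℕ.z≤n ∷ [] , refl , (λ ()) ,
    trans (cf-split-last (suc b)) (cf-euclid-∷ (suc (suc b)) 0 n d [] D≡ (ℕ.s≤s ℕ.z≤n) [] (sym (0/n≡0 (suc n))))

  cf-expansion : ∀ n d p → suc n ℕ.< suc d → Expansion n d p
  cf-expansion = <-rec (λ n → ∀ d p → suc n ℕ.< suc d → Expansion n d p) step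
    where
    step : ∀ n → (∀ {m} → m ℕ.< n → ∀ d p → suc m ℕ.< suc d → Expansion m d p) →
           ∀ d p → suc n ℕ.< suc d → Expansion n d p
    step n rec d p N<D = go (suc d div suc n) (suc d % suc n) D≡ (m≥n⇒m/n>0 (ℕ.<⇒≤ N<D)) (m%n<n (suc d) (suc n))
      where
      D≡ : suc d ≡ (suc d div suc n) ℕ.* suc n ℕ.+ suc d % suc n
      D≡ = trans (m≡m%n+[m/n]*n (suc d) (suc n)) (ℕ.+-comm (suc d % suc n) _)
      go : ∀ b r → suc d ≡ b ℕ.* suc n ℕ.+ r → 1 ℕ.≤ b → r ℕ.< suc n → Expansion n d p
      go zero          _        _   ()
      go (suc zero)    zero     D≡N _  _ = ⊥-elim (ℕ.<-irrefl (sym (trans D≡N (trans (ℕ.+-identityʳ _) (ℕ.*-identityˡ (suc n))))) N<D)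
      go (suc (suc b)) zero     D≡  _  _ = cf-expansion-last b n d p D≡
      go b (suc r') D≡ pb r<N with rec (ℕ.s<s⁻¹ r<N) n (not p) r<N
      ... | L' , pL' , evenL' , _ , eL' =
        b ∷ L' , pb ∷ pL' , trans (cong not evenL') (not-involutive p) , (λ ()) , cf-euclid-∷ b (suc r') n d L' D≡ pb pL' eL'

open import Defs
open import Data.Product using (_×_; ∃)
open import Data.Rational using (ℚ; 0ℚ; 1ℚ; _<_)
open import Function.Definitions using (Injective)
open import Relation.Binary.PropositionalEquality using (_≡_)

open Decomposition using (Admissible; digitsOf; digitsOf-admissible; digitsOf-injective; digitsOf-surjective)
open ContinuedFractions
open import Data.Bool using (true; false)
open import Data.Bool.Properties using (not-involutive)
open import Data.List using ([]; _∷_)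
open import Data.List.Relation.Unary.All using (_∷_)
open import Data.Product using (_,_; proj₁; proj₂)
open import Data.Empty using (⊥-elim)
open import Data.Integer using (+_; -[1+_])
import Data.Integer as ℤ
import Data.Integer.Properties as ℤ
import Data.Nat as ℕ
open import Data.Nat.Coprimality using (Coprime)
open import Data.Rational using (-_; mkℚ; positive)
open import Data.Rational.Properties
  using (<-cmp; <-irrefl; <-trans; <-≤-trans; ↥p/↧p≡p; drop-*<*; neg-antimono-<; neg-injective; +-0-group)
open import Algebra.Properties.Group +-0-group using (⁻¹-involutive)
open import Function using (_∘_)
open import Relation.Binary.PropositionalEquality using (refl; sym; trans; cong; cong₂; subst₂)
open import Relation.Binary.Definitions using (tri<; tri≈; tri>)

complement-involutive : ∀ v → complement (complement v) ≡ v
complement-involutive []      = refl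
complement-involutive (x ∷ v) = cong₂ _∷_ (not-involutive x) (complement-involutive v)

complement-injective : ∀ {u w} → complement u ≡ complement w → u ≡ w
complement-injective {u} {w} e = trans (sym (complement-involutive u)) (trans (cong complement e) (complement-involutive w))

admissible-range : ∀ L → Admissible L → (0ℚ < cf L) × (cf L < 1ℚ)
admissible-range []         adm = ⊥-elim (Admissible.nonempty adm refl)
admissible-range L@(b ∷ bs) adm with Admissible.allPositive adm
... | pb ∷ pbs = cf-positive b bs pb pbs , below1
  where
  open Admissible adm
  below1 : cf L < 1ℚ
  below1 with <-cmp (cf L) 1ℚ
  ... | tri< lt _ _ = lt
  ... | tri≈ _ e _ with cf≡1 L allPositive e | evenLength
  ...   | refl | ()
  below1 | tri> _ _ gt = ⊥-elim (<-irrefl refl (<-≤-trans gt (cf-≤1 L allPositive)))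

V-range : ∀ v → (0ℚ < ?V⁻¹ v) × (?V⁻¹ v < 1ℚ)
V-range v = admissible-range (digitsOf v) (digitsOf-admissible v)

V-injective : Injective _≡_ _≡_ ?V⁻¹
V-injective {v} {v'} e =
  digitsOf-injective (cf-injective (digitsOf v) (digitsOf v') allPositive allPositive' (trans evenLength (sym evenLength')) e)
  where
  open Admissible (digitsOf-admissible v)
  open Admissible (digitsOf-admissible v') renaming (allPositive to allPositive'; evenLength to evenLength')

numerator<denominator : ∀ n d .(c : Coprime (ℕ.suc n) (ℕ.suc d)) → mkℚ (+ ℕ.suc n) d c < 1ℚ → ℕ.suc n ℕ.< ℕ.suc d
numerator<denominator n d c q<1 = ℤ.drop‿+<+ (subst₂ ℤ._<_ (ℤ.*-identityʳ (+ ℕ.suc n)) (ℤ.*-identityˡ (+ ℕ.suc d)) (drop-*<* q<1))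

V-surjective : ∀ q → 0ℚ < q → q < 1ℚ → ∃ λ v → ?V⁻¹ v ≡ q
V-surjective (mkℚ (+ ℕ.zero) _ _) q>0 _ with positive q>0
... | ()
V-surjective (mkℚ -[1+ _ ] _ _) q>0 _ with positive q>0
... | ()
V-surjective q@(mkℚ (+ ℕ.suc n) d c) _ q<1 with cf-expansion n d true (numerator<denominator n d c q<1)
... | L , pL , evenL , neL , eL with digitsOf-surjective L (record { allPositive = pL ; evenLength = evenL ; nonempty = neL })
...   | v , ev = v , trans (cong cf ev) (trans eL (↥p/↧p≡p q))

V>0 : ∀ v → 0ℚ < ?V⁻¹ v
V>0 v = proj₁ (V-range v)

V<1 : ∀ v → ?V⁻¹ v < 1ℚ
V<1 v = proj₂ (V-range v)

recipV>1 : ∀ v → 1ℚ < recipℚ (?V⁻¹ v)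
recipV>1 v = recip-antitone-< (?V⁻¹ v) 1ℚ (V>0 v) (V<1 v)

hat-positive : ∀ v → 0ℚ < ?̂⁻¹ v
hat-positive []          = 0<1
hat-positive (false ∷ v) = V>0 v
hat-positive (true ∷ v)  = recip-positive _ (V>0 (complement v))

hat-injective : Injective _≡_ _≡_ ?̂⁻¹
hat-injective {[]}        {[]}        e = refl
hat-injective {[]}        {false ∷ w} e = ⊥-elim (<-irrefl (sym e) (V<1 w))
hat-injective {[]}        {true ∷ w}  e = ⊥-elim (<-irrefl e (recipV>1 (complement w)))
hat-injective {false ∷ v} {[]}        e = ⊥-elim (<-irrefl e (V<1 v))
hat-injective {true ∷ v}  {[]}        e = ⊥-elim (<-irrefl (sym e) (recipV>1 (complement v)))
hat-injective {false ∷ v} {false ∷ w} e = cong (false ∷_) (V-injective e)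
hat-injective {false ∷ v} {true ∷ w}  e = ⊥-elim (<-irrefl e (<-trans (V<1 v) (recipV>1 (complement w))))
hat-injective {true ∷ v}  {false ∷ w} e = ⊥-elim (<-irrefl (sym e) (<-trans (V<1 w) (recipV>1 (complement v))))
hat-injective {true ∷ v}  {true ∷ w}  e =
  cong (true ∷_) (complement-injective (V-injective (recip-injective _ _ (V>0 (complement v)) (V>0 (complement w)) e)))

hat-surjective : ∀ q → 0ℚ < q → ∃ λ v → ?̂⁻¹ v ≡ q
hat-surjective q q>0 with <-cmp q 1ℚ
... | tri< q<1 _ _ with V-surjective q q>0 q<1
...   | v , e = false ∷ v , e
hat-surjective q q>0 | tri≈ _ refl _ = [] , refl
hat-surjective q q>0 | tri> _ _ q>1 with V-surjective (recipℚ q) (recip-positive q q>0) (recip-antitone-< 1ℚ q 0<1 q>1)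
...   | u , e = true ∷ complement u ,
                trans (cong (recipℚ ∘ ?V⁻¹) (complement-involutive u)) (trans (cong recipℚ e) (recip-involutive q q>0))

negHat<0 : ∀ v → - ?̂⁻¹ v < 0ℚ
negHat<0 v = neg-antimono-< (hat-positive v)

hathat-injective : Injective _≡_ _≡_ ?̂̂⁻¹
hathat-injective {[]}        {[]}        e = refl
hathat-injective {[]}        {false ∷ w} e = ⊥-elim (<-irrefl (sym e) (negHat<0 (complement w)))
hathat-injective {[]}        {true ∷ w}  e = ⊥-elim (<-irrefl e (hat-positive w))
hathat-injective {false ∷ v} {[]}        e = ⊥-elim (<-irrefl e (negHat<0 (complement v)))
hathat-injective {true ∷ v}  {[]}        e = ⊥-elim (<-irrefl (sym e) (hat-positive v))
hathat-injective {false ∷ v} {false ∷ w} e = cong (false ∷_) (complement-injective (hat-injective (neg-injective e)))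
hathat-injective {false ∷ v} {true ∷ w}  e = ⊥-elim (<-irrefl e (<-trans (negHat<0 (complement v)) (hat-positive w)))
hathat-injective {true ∷ v}  {false ∷ w} e = ⊥-elim (<-irrefl (sym e) (<-trans (negHat<0 (complement w)) (hat-positive v)))
hathat-injective {true ∷ v}  {true ∷ w}  e = cong (true ∷_) (hat-injective e)

hathat-surjective : ∀ q → ∃ λ v → ?̂̂⁻¹ v ≡ q
hathat-surjective q with <-cmp q 0ℚ
... | tri< q<0 _ _ with hat-surjective (- q) (neg-antimono-< q<0)
...   | u , e = false ∷ complement u ,
                trans (cong (λ t → - ?̂⁻¹ t) (complement-involutive u)) (trans (cong -_ e) (⁻¹-involutive q))
hathat-surjective q | tri≈ _ refl _ = [] , refl
hathat-surjective q | tri> _ _ q>0 with hat-surjective q q>0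
...   | v , e = true ∷ v , e

mainTheorem1 : ((∀ v → (0ℚ < ?V⁻¹ v) × (?V⁻¹ v < 1ℚ))
    × Injective _≡_ _≡_ ?V⁻¹
    × (∀ q → 0ℚ < q → q < 1ℚ → ∃ λ v → ?V⁻¹ v ≡ q))
    × ((∀ v → 0ℚ < ?̂⁻¹ v)
    × Injective _≡_ _≡_ ?̂⁻¹
    × (∀ q → 0ℚ < q → ∃ λ v → ?̂⁻¹ v ≡ q))
    × (Injective _≡_ _≡_ ?̂̂⁻¹
    × (∀ q → ∃ λ v → ?̂̂⁻¹ v ≡ q))
mainTheorem1 =
  (V-range , V-injective , V-surjective) ,
  (hat-positive , hat-injective , hat-surjective) ,
  (hathat-injective , hathat-surjective)
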